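{- For $H_1, H_2\in\mathcal{H}$, if $H_1\le H_2$ then $\dim H_1\le \dim H_2$.
   Context: All graphs are finite and simple, considered up to isomorphism. An edge-colored graph is a pair $(G,c)$ with $c\colon E(G)\to\mathbb{N}$ an arbitrary map (not necessarily proper); it is colored in $t$ or more colors if $|c(E(G))|\ge t$. A subgraph (not necessarily induced) is rainbow if its edges receive pairwise distinct colors. $(G,c)$ is rainbow $H$-free if $G$ contains no rainbow subgraph isomorphic to $H$. For graphs $H_1,H_2$, write $H_1\le H_2$ if there is a positive integer $t$ such that every rainbow $H_1$-free edge-colored complete graph colored in $t$ or more colors is rainbow $H_2$-free. $\mathcal{H}$ denotes the set of connected finite simple graphs other than the paths $P_1,P_2,P_3,P_4$ ($P_k$ is the path on $k$ vertices). For a connected graph $G$, $\dim G=|E(G)|-|V(G)|+1$. -}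

module Defs where

open import Data.Nat using (ℕ; zero; suc; _<_; _<ᵇ_)
open import Data.Nat.Properties using (n<1+n; <-irrefl)
import Data.Nat as ℕ
open import Data.Bool using (Bool; true; false; T; _∧_; _∨_; if_then_else_)
open import Data.Bool.Properties using (∨-comm)
open import Data.Fin using (Fin; toℕ)
open import Data.List using (List; map; allFin)
open import Data.Nat.ListAction using (sum)
open import Data.Integer as ℤ using (ℤ; +_)
open import Data.Product using (Σ; _×_; _,_; proj₁; proj₂; ∃)
open import Data.Sum using (_⊎_)
open import Data.Empty using (⊥-elim)
open import Relation.Nullary using (¬_; yes; no)
open import Relation.Nullary.Decidable using (⌊_⌋)
open import Relation.Binary.PropositionalEquality using (_≡_; _≢_; refl; sym)

record Graph : Set where
  field
    n      : ℕ
    adj    : Fin n → Fin n → Bool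
    adj-sym    : ∀ i j → adj i j ≡ adj j i
    adj-irrefl : ∀ i → adj i i ≡ false
open Graph public

edgeCount : Graph → ℕ
edgeCount G = sum (map (λ i → sum (map (λ j →
    if adj G i j ∧ (toℕ i <ᵇ toℕ j) then 1 else 0) (allFin (n G)))) (allFin (n G)))

dim : Graph → ℤ
dim G = (+ edgeCount G) ℤ.- (+ n G) ℤ.+ (+ 1)

record Iso (G H : Graph) : Set where
  field
    to      : Fin (n G) → Fin (n H)
    from    : Fin (n H) → Fin (n G)
    from∘to : ∀ i → from (to i) ≡ i
    to∘from : ∀ j → to (from j) ≡ j
    preserves : ∀ i j → adj H (to i) (to j) ≡ adj G i j

data Reach (G : Graph) : Fin (n G) → Fin (n G) → Set where
  here : ∀ {u} → Reach G u u
  step : ∀ {u w v} → T (adj G u w) → Reach G w v → Reach G u v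

Connected : Graph → Set
Connected G = (0 < n G) × (∀ u v → Reach G u v)

pathAdj : (k : ℕ) → Fin k → Fin k → Bool
pathAdj k i j = ⌊ suc (toℕ i) ℕ.≟ toℕ j ⌋ ∨ ⌊ suc (toℕ j) ℕ.≟ toℕ i ⌋

pathAdj-irrefl : ∀ k (i : Fin k) → pathAdj k i i ≡ false
pathAdj-irrefl k i with suc (toℕ i) ℕ.≟ toℕ i
... | yes p = ⊥-elim (<-irrefl (sym p) (n<1+n (toℕ i)))
... | no _ = refl

P : ℕ → Graph
P k = record
  { n = k
  ; adj = pathAdj k
  ; adj-sym = λ i j → ∨-comm (⌊ suc (toℕ i) ℕ.≟ toℕ j ⌋) (⌊ suc (toℕ j) ℕ.≟ toℕ i ⌋)
  ; adj-irrefl = pathAdj-irrefl k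
  }

InℋClass : Graph → Set
InℋClass H = Connected H × ¬ Iso H (P 1) × ¬ Iso H (P 2) × ¬ Iso H (P 3) × ¬ Iso H (P 4)

-- Edge-colorings of the complete graph K_m (vertex set Fin m).
-- The color of edge {i,j} (i ≢ j) is c i j; c is required symmetric;
-- diagonal values are irrelevant.

Coloring : ℕ → Set
Coloring m = Fin m → Fin m → ℕ

SymColoring : (m : ℕ) → Coloring m → Set
SymColoring m c = ∀ i j → c i j ≡ c j i

-- |c(E(K_m))| ≥ t : there are t edges with pairwise distinct colors
ColoredInAtLeast : (m : ℕ) → Coloring m → ℕ → Set
ColoredInAtLeast m c t =
  Σ (Fin t → Fin m × Fin m) λ f →
    (∀ k → proj₁ (f k) ≢ proj₂ (f k)) ×
    (∀ k l → c (proj₁ (f k)) (proj₂ (f k)) ≡ c (proj₁ (f l)) (proj₂ (f l)) → k ≡ l)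

RainbowCopy : (H : Graph) (m : ℕ) → Coloring m → Set
RainbowCopy H m c =
  Σ (Fin (n H) → Fin m) λ φ →
    (∀ u v → φ u ≡ φ v → u ≡ v) ×
    (∀ u v u' v' → T (adj H u v) → T (adj H u' v') →
       c (φ u) (φ v) ≡ c (φ u') (φ v') →
       (u ≡ u' × v ≡ v') ⊎ (u ≡ v' × v ≡ u'))

RainbowFree : (H : Graph) (m : ℕ) → Coloring m → Set
RainbowFree H m c = ¬ RainbowCopy H m c

_≼_ : Graph → Graph → Set
H₁ ≼ H₂ = ∃ λ t → ∀ (m : ℕ) (c : Coloring m) → SymColoring m c →
  ColoredInAtLeast m c t → RainbowFree H₁ m c → RainbowFree H₂ m c

{-# OPTIONS --safe #-}
-- For every t, colour a complete graph containing H₂ as follows. Fix a breadth-first spanning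
-- tree of H₂ and order the vertices by depth. Each edge of H₂ outside the tree gets a colour of
-- its own; every other edge gets the colour of its later endpoint. Then H₂ is rainbow, since
-- each tree edge is coloured by its child, and t + 1 added vertices supply t colours. In a
-- rainbow copy of a connected H, the edges not mapped to non-tree edges of H₂ have distinct
-- later endpoints, none of them the earliest vertex of H, so
-- |E(H)| ≤ |V(H)| - 1 + (|E(H₂)| - |V(H₂)| + 1), that is dim H ≤ dim H₂. Hence if
-- dim H₁ > dim H₂, these colourings are rainbow H₁-free but not rainbow H₂-free.
module Submission where

open import Defs
open import Data.Bool using (Bool; true; false; T; not; _∧_; _∨_; if_then_else_)
open import Data.Bool.Properties using (T-∧; T-∨; ∧-identityʳ; ∧-comm; ∨-comm)
open import Data.Empty using (⊥-elim)
open import Data.Fin using (Fin; zero; suc; toℕ; fromℕ<; _↑ˡ_; _↑ʳ_; splitAt; remQuot; combine)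
open import Data.Fin.Properties
  using (_≟_; 0≢1+n; suc-injective; toℕ-injective; toℕ<n; toℕ-↑ˡ; toℕ-↑ʳ; ↑ˡ-injective;
         ↑ʳ-injective; splitAt-↑ˡ; splitAt-↑ʳ; splitAt⁻¹-↑ˡ; remQuot-combine; combine-injective;
         *↔×; any?)
open import Data.List using (allFin; map)
open import Data.List.Properties using (map-tabulate; map-cong)
open import Data.List.Extrema.Nat using (argmin; f[argmin]≤f[xs])
open import Data.List.Membership.Propositional.Properties using (∈-allFin)
import Data.List.Relation.Unary.All as All
open import Data.Nat
  using (ℕ; zero; suc; _+_; _*_; _≤_; _<_; z≤n; s≤s; _<ᵇ_; _≡ᵇ_)
open import Data.Nat.DivMod using (_%_; [m+kn]%n≡m%n; m<n⇒m%n≡m)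
open import Data.Nat.ListAction using (sum)
open import Data.Nat.Properties
  using (+-suc; +-comm; +-identityʳ; +-cancelˡ-≡; ≤-reflexive; ≤-trans; ≤-<-trans; <-asym;
         <-irrefl; <-cmp; <ᵇ⇒<; <⇒<ᵇ; ≡ᵇ⇒≡; ≡⇒≡ᵇ; m≤m+n; m≤n+m; m+n∸m≡n; +-mono-≤; +-monoˡ-≤;
         +-monoʳ-<; +-monoˡ-<; *-monoˡ-≤; module ≤-Reasoning)
import Data.Integer as ℤ
open import Data.Integer using (_⊖_)
import Data.Integer.Properties as ℤₚ
open import Data.Product using (∃; _×_; _,_; proj₁; proj₂; swap; uncurry)
open import Data.Product.Properties using (,-injective)
open import Data.Sum using (_⊎_; inj₁; inj₂; [_,_]′)
open import Function using (_∘_; id; const; _↔_; Inverse; Injection; Equivalence)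
open import Function.Properties.Inverse using (↔-refl; ↔-sym; Inverse⇒Injection)
open import Function.Definitions using (Injective)
open import Relation.Binary.Definitions using (tri<; tri≈; tri>)
open import Relation.Binary.PropositionalEquality
open import Relation.Nullary using (¬_; yes; no)
open import Relation.Nullary.Decidable using (⌊_⌋; T?; toWitness; fromWitness; decidable-stable)

T-not : ∀ {b} → ¬ T b → T (not b)
T-not {false} _  = _
T-not {true}  ¬b = ¬b _

T-not⁻ : ∀ {b} → T (not b) → ¬ T b
T-not⁻ {false} _ ()

∧-intro : ∀ {a b} → T a → T b → T (a ∧ b)
∧-intro p q = Equivalence.from T-∧ (p , q)

∧-elimˡ : ∀ {a b} → T (a ∧ b) → T a
∧-elimˡ = proj₁ ∘ Equivalence.to T-∧

∧-elimʳ : ∀ {a b} → T (a ∧ b) → T b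
∧-elimʳ {a} = proj₂ ∘ Equivalence.to (T-∧ {a})

-- Unlike ⌊ i ≟ j ⌋, this reduces under suc, which the counting lemmas below rely on.
_==_ : ∀ {n} → Fin n → Fin n → Bool
i == j = toℕ i ≡ᵇ toℕ j

==⇒≡ : ∀ {n} {i j : Fin n} → T (i == j) → i ≡ j
==⇒≡ {i = i} {j} = toℕ-injective ∘ ≡ᵇ⇒≡ (toℕ i) (toℕ j)

≡⇒== : ∀ {n} {i j : Fin n} → i ≡ j → T (i == j)
≡⇒== {i = i} {j} = ≡⇒≡ᵇ (toℕ i) (toℕ j) ∘ cong toℕ

≢⇒not== : ∀ {n} {i j : Fin n} → i ≢ j → T (not (i == j))
≢⇒not== i≢j = T-not (i≢j ∘ ==⇒≡)

not==⇒≢ : ∀ {n} {i j : Fin n} → T (not (i == j)) → i ≢ j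
not==⇒≢ p = T-not⁻ p ∘ ≡⇒==

-- Counting

count : ∀ {n} → (Fin n → Bool) → ℕ
count {zero}  P = 0
count {suc n} P = if P zero then suc (count (P ∘ suc)) else count (P ∘ suc)

count-cong : ∀ {n} {P Q : Fin n → Bool} → (∀ i → P i ≡ Q i) → count P ≡ count Q
count-cong {zero}          eq = refl
count-cong {suc n} {P} {Q} eq rewrite eq zero with Q zero
... | true  = cong suc (count-cong (eq ∘ suc))
... | false = count-cong (eq ∘ suc)

count-split : ∀ {n} (P Q : Fin n → Bool) →
  count P ≡ count (λ i → P i ∧ Q i) + count (λ i → P i ∧ not (Q i))
count-split {zero}  P Q = refl
count-split {suc n} P Q with P zero | Q zero
... | false | _     = count-split (P ∘ suc) (Q ∘ suc)
... | true  | true  = cong suc (count-split (P ∘ suc) (Q ∘ suc))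
... | true  | false = trans (cong suc (count-split (P ∘ suc) (Q ∘ suc))) (sym (+-suc _ _))

count-true : ∀ n → count {n} (const true) ≡ n
count-true zero    = refl
count-true (suc n) = cong suc (count-true n)

count-≢ : ∀ {n} (w : Fin n) → suc (count (λ i → not (i == w))) ≡ n
count-≢ {suc n} zero    = cong suc (count-true n)
count-≢ {suc n} (suc w) = cong suc (count-≢ w)

count-remove : ∀ {n} (Q : Fin n → Bool) {j} → T (Q j) →
  count Q ≡ suc (count (λ i → Q i ∧ not (i == j)))
count-remove {suc n} Q {zero} q with Q zero
... | true = cong suc (count-cong λ i → sym (∧-identityʳ (Q (suc i))))
count-remove {suc n} Q {suc j} q with Q zero
... | true  = cong suc (count-remove (Q ∘ suc) q)
... | false = count-remove (Q ∘ suc) q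

count-↑ : ∀ {k l} (P : Fin (k + l) → Bool) →
  count P ≡ count (P ∘ (_↑ˡ l)) + count (P ∘ (k ↑ʳ_))
count-↑ {zero}  P = refl
count-↑ {suc k} P with P zero
... | true  = cong suc (count-↑ {k} (P ∘ suc))
... | false = count-↑ {k} (P ∘ suc)

sum-allFin-suc : ∀ {n} (f : Fin (suc n) → ℕ) →
  sum (map f (allFin (suc n))) ≡ f zero + sum (map (f ∘ suc) (allFin n))
sum-allFin-suc {n} f = cong (λ xs → f zero + sum xs)
  (trans (map-tabulate suc f) (sym (map-tabulate id (f ∘ suc))))

count≡sum : ∀ {n} (P : Fin n → Bool) →
  count P ≡ sum (map (λ i → if P i then 1 else 0) (allFin n))
count≡sum {zero}  P = refl
count≡sum {suc n} P = trans head+count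
  (sym (trans (sum-allFin-suc ind) (cong (ind zero +_) (sym (count≡sum (P ∘ suc))))))
  where
  ind : Fin (suc n) → ℕ
  ind i = if P i then 1 else 0
  head+count : count P ≡ ind zero + count (P ∘ suc)
  head+count with P zero
  ... | true  = refl
  ... | false = refl

InjectiveOn : {A B : Set} → (A → Bool) → (A → B) → Set
InjectiveOn P f = ∀ {x y} → T (P x) → T (P y) → f x ≡ f y → x ≡ y

injectiveOn⇒count≤ : ∀ {k l} {P : Fin k → Bool} {Q : Fin l → Bool} (f : Fin k → Fin l) →
  (∀ i → T (P i) → T (Q (f i))) → InjectiveOn P f → count P ≤ count Q
injectiveOn⇒count≤ {zero}  f maps inj = z≤n
injectiveOn⇒count≤ {suc k} {P = P} {Q} f maps inj with P zero in eq
... | false = injectiveOn⇒count≤ (f ∘ suc) (maps ∘ suc) (λ p q → suc-injective ∘ inj p q)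
... | true  = begin
  suc (count (P ∘ suc))
    ≤⟨ s≤s (injectiveOn⇒count≤ (f ∘ suc) maps′ (λ p q → suc-injective ∘ inj p q)) ⟩
  suc (count Q′)
    ≡⟨ count-remove Q (maps zero p₀) ⟨
  count Q ∎
  where
  open ≤-Reasoning
  p₀ : T (P zero)
  p₀ = subst T (sym eq) _
  Q′ : Fin _ → Bool
  Q′ j = Q j ∧ not (j == f zero)
  maps′ : ∀ i → T (P (suc i)) → T (Q′ (f (suc i)))
  maps′ i p = ∧-intro (maps (suc i) p) (≢⇒not== λ e → 0≢1+n (inj p₀ p (sym e)))

countIn : ∀ {k} {A : Set} → Fin k ↔ A → (A → Bool) → ℕ
countIn e P = count (P ∘ Inverse.to e)

injectiveOn⇒countIn≤ : ∀ {k l} {A B : Set} (e : Fin k ↔ A) (e′ : Fin l ↔ B)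
  {P : A → Bool} {Q : B → Bool} (f : A → B) → (∀ x → T (P x) → T (Q (f x))) →
  InjectiveOn P f → countIn e P ≤ countIn e′ Q
injectiveOn⇒countIn≤ e e′ {Q = Q} f maps inj =
  injectiveOn⇒count≤ (Inverse.from e′ ∘ f ∘ Inverse.to e)
    (λ i p → subst (T ∘ Q) (sym (Inverse.strictlyInverseˡ e′ _)) (maps _ p))
    (λ p q → injective e ∘ inj p q ∘ injective (↔-sym e′))
  where
  injective : ∀ {A B : Set} (e : A ↔ B) → Injective _≡_ _≡_ (Inverse.to e)
  injective = Injection.injective ∘ Inverse⇒Injection

Pair : ℕ → Set
Pair n = Fin n × Fin n

remQuot-↑ʳ : ∀ {k} l (x : Fin (k * l)) →
  remQuot {suc k} l (l ↑ʳ x) ≡ (suc (proj₁ (remQuot {k} l x)) , proj₂ (remQuot {k} l x))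
remQuot-↑ʳ {k} l x rewrite splitAt-↑ʳ l (k * l) x = refl

countIn-*↔× : ∀ {k l} (P : Fin k × Fin l → Bool) →
  countIn *↔× P ≡ sum (map (λ i → count (λ j → P (i , j))) (allFin k))
countIn-*↔× {zero}      P = refl
countIn-*↔× {suc k} {l} P = begin
  count (P ∘ remQuot l)
    ≡⟨ count-↑ {l} (P ∘ remQuot l) ⟩
  count (P ∘ remQuot l ∘ (_↑ˡ k * l)) + count (P ∘ remQuot l ∘ (l ↑ʳ_))
    ≡⟨ cong₂ _+_ (count-cong (λ j → cong P (remQuot-combine zero j)))
                 (count-cong (λ x → cong P (remQuot-↑ʳ l x))) ⟩
  count (λ j → P (zero , j)) + countIn *↔× (λ (i , j) → P (suc i , j))
    ≡⟨ cong (count (λ j → P (zero , j)) +_) (countIn-*↔× (λ (i , j) → P (suc i , j))) ⟩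
  count (λ j → P (zero , j)) + sum (map (λ i → count (λ j → P (suc i , j))) (allFin k))
    ≡⟨ sum-allFin-suc (λ i → count (λ j → P (i , j))) ⟨
  sum (map (λ i → count (λ j → P (i , j))) (allFin (suc k))) ∎
  where open ≡-Reasoning

-- Unordered pairs and edges

sortBy : {A : Set} → (A → ℕ) → A → A → A × A
sortBy κ x y = if κ x <ᵇ κ y then (x , y) else (y , x)

larger : {A : Set} → (A → ℕ) → A → A → A
larger κ x y = proj₂ (sortBy κ x y)

module _ {A : Set} (κ : A → ℕ) {x y : A} where

  sortBy-cases : sortBy κ x y ≡ (x , y) ⊎ sortBy κ x y ≡ (y , x)
  sortBy-cases with κ x <ᵇ κ y
  ... | true  = inj₁ refl
  ... | false = inj₂ refl

  sortBy-< : κ x < κ y → sortBy κ x y ≡ (x , y)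
  sortBy-< x<y with κ x <ᵇ κ y | <⇒<ᵇ x<y
  ... | true | _ = refl

  sortBy-> : κ y < κ x → sortBy κ x y ≡ (y , x)
  sortBy-> y<x with κ x <ᵇ κ y in eq
  ... | true  = ⊥-elim (<-asym y<x (<ᵇ⇒< _ _ (subst T (sym eq) _)))
  ... | false = refl

larger-> : ∀ {A : Set} (κ : A → ℕ) {x y} → κ y < κ x → larger κ x y ≡ x
larger-> κ y<x = cong proj₂ (sortBy-> κ y<x)

larger-∘ : ∀ {A B : Set} (κ : A → ℕ) (f : B → A) {u v} →
  f (larger (κ ∘ f) u v) ≡ larger κ (f u) (f v)
larger-∘ κ f {u} {v} with κ (f u) <ᵇ κ (f v)
... | true  = refl
... | false = refl

module _ {A : Set} {κ : A → ℕ} (κ-injective : Injective _≡_ _≡_ κ) where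

  sortBy-comm : ∀ x y → sortBy κ x y ≡ sortBy κ y x
  sortBy-comm x y with <-cmp (κ x) (κ y)
  ... | tri< x<y _ _ = trans (sortBy-< κ x<y) (sym (sortBy-> κ x<y))
  ... | tri≈ _ x≡y _ rewrite κ-injective x≡y = refl
  ... | tri> _ _ y<x = trans (sortBy-> κ y<x) (sym (sortBy-< κ y<x))

  sortBy-sorted : ∀ {x y} → x ≢ y → κ (proj₁ (sortBy κ x y)) < κ (proj₂ (sortBy κ x y))
  sortBy-sorted {x} {y} x≢y with <-cmp (κ x) (κ y)
  ... | tri< x<y _ _ rewrite sortBy-< κ x<y = x<y
  ... | tri≈ _ x≡y _ = ⊥-elim (x≢y (κ-injective x≡y))
  ... | tri> _ _ y<x rewrite sortBy-> κ y<x = y<x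

⟪_,_⟫ : ∀ {n} → Fin n → Fin n → Pair n
⟪_,_⟫ = sortBy toℕ

⟪⟫-comm : ∀ {n} (x y : Fin n) → ⟪ x , y ⟫ ≡ ⟪ y , x ⟫
⟪⟫-comm = sortBy-comm toℕ-injective

SameEdge : {A : Set} → A → A → A → A → Set
SameEdge u v u′ v′ = (u ≡ u′ × v ≡ v′) ⊎ (u ≡ v′ × v ≡ u′)

module _ {n} {x y x′ y′ : Fin n} where

  SameEdge⇒⟪⟫≡ : SameEdge x y x′ y′ → ⟪ x , y ⟫ ≡ ⟪ x′ , y′ ⟫
  SameEdge⇒⟪⟫≡ (inj₁ (refl , refl)) = refl
  SameEdge⇒⟪⟫≡ (inj₂ (refl , refl)) = ⟪⟫-comm x y

  ⟪⟫≡⇒SameEdge : ⟪ x , y ⟫ ≡ ⟪ x′ , y′ ⟫ → SameEdge x y x′ y′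
  ⟪⟫≡⇒SameEdge eq with sortBy-cases toℕ {x} {y} | sortBy-cases toℕ {x′} {y′}
  ... | inj₁ e | inj₁ e′ = inj₁ (,-injective (trans (sym e) (trans eq e′)))
  ... | inj₁ e | inj₂ e′ = inj₂ (,-injective (trans (sym e) (trans eq e′)))
  ... | inj₂ e | inj₁ e′ = inj₂ (swap (,-injective (trans (sym e) (trans eq e′))))
  ... | inj₂ e | inj₂ e′ = inj₁ (swap (,-injective (trans (sym e) (trans eq e′))))

SameEdge-injective : ∀ {A B : Set} {f : A → B} → Injective _≡_ _≡_ f →
  ∀ {u v u′ v′} → SameEdge (f u) (f v) (f u′) (f v′) → SameEdge u v u′ v′
SameEdge-injective inj (inj₁ (p , q)) = inj₁ (inj p , inj q)
SameEdge-injective inj (inj₂ (p , q)) = inj₂ (inj p , inj q)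

SameEdge-map : ∀ {A B : Set} (f : A → B) {u v u′ v′} →
  SameEdge u v u′ v′ → SameEdge (f u) (f v) (f u′) (f v′)
SameEdge-map f (inj₁ (refl , refl)) = inj₁ (refl , refl)
SameEdge-map f (inj₂ (refl , refl)) = inj₂ (refl , refl)

SameEdge-< : ∀ {n} {i j i′ j′ : Fin n} → toℕ i < toℕ j → toℕ i′ < toℕ j′ →
  SameEdge i j i′ j′ → (i , j) ≡ (i′ , j′)
SameEdge-< _   _     (inj₁ (refl , refl)) = refl
SameEdge-< i<j i′<j′ (inj₂ (refl , refl)) = ⊥-elim (<-asym i<j i′<j′)

upper : ∀ {n} → (Fin n → Fin n → Bool) → Pair n → Bool
upper R (i , j) = R i j ∧ (toℕ i <ᵇ toℕ j)

upper-< : ∀ {n} {R : Fin n → Fin n → Bool} {i j} → T (upper R (i , j)) → toℕ i < toℕ j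
upper-< {R = R} {i} {j} e = <ᵇ⇒< (toℕ i) (toℕ j) (∧-elimʳ {R i j} e)

upper-⟪⟫ : ∀ {n} {R : Fin n → Fin n → Bool} → (∀ x y → R x y ≡ R y x) →
  ∀ {x y} → x ≢ y → T (R x y) → T (upper R ⟪ x , y ⟫)
upper-⟪⟫ {R = R} R-sym {x} {y} x≢y r = ∧-intro sorted-edge (<⇒<ᵇ (sortBy-sorted toℕ-injective x≢y))
  where
  sorted-edge : T (R (proj₁ ⟪ x , y ⟫) (proj₂ ⟪ x , y ⟫))
  sorted-edge with sortBy-cases toℕ {x} {y}
  ... | inj₁ e rewrite e = r
  ... | inj₂ e rewrite e = subst T (R-sym x y) r

countEdges : ∀ {n} → (Fin n → Fin n → Bool) → ℕ
countEdges R = countIn *↔× (upper R)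

edgeCount≡countEdges : ∀ G → edgeCount G ≡ countEdges (adj G)
edgeCount≡countEdges G = trans
  (cong sum (map-cong (λ i → sym (count≡sum (λ j → upper (adj G) (i , j)))) (allFin (n G))))
  (sym (countIn-*↔× (upper (adj G))))

countEdges-split : ∀ {n} (R Q : Fin n → Fin n → Bool) →
  countEdges R ≡ countEdges (λ i j → R i j ∧ Q i j) + countEdges (λ i j → R i j ∧ not (Q i j))
countEdges-split {n} R Q = trans (count-split (upper R ∘ to) (uncurry Q ∘ to))
  (cong₂ _+_ (count-cong λ p → swapʳ (uncurry R (to p)) (lt (to p)) (uncurry Q (to p)))
             (count-cong λ p → swapʳ (uncurry R (to p)) (lt (to p)) (not (uncurry Q (to p)))))
  where
  to = Inverse.to (*↔× {n} {n})
  lt : Pair n → Bool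
  lt (i , j) = toℕ i <ᵇ toℕ j
  swapʳ : ∀ a b c → (a ∧ b) ∧ c ≡ (a ∧ c) ∧ b
  swapʳ true  b c = ∧-comm b c
  swapʳ false b c = refl

adj⇒≢ : ∀ (G : Graph) {u v} → T (adj G u v) → u ≢ v
adj⇒≢ G {u} a refl = subst T (adj-irrefl G u) a

edgeInjective⇒countEdges≤ : ∀ {k} {R : Fin k → Fin k → Bool} (G : Graph) (φ : Fin k → Fin (n G)) →
  (∀ {i j} → T (R i j) → T (adj G (φ i) (φ j))) →
  (∀ {i j i′ j′} → T (R i j) → T (R i′ j′) →
     SameEdge (φ i) (φ j) (φ i′) (φ j′) → SameEdge i j i′ j′) →
  countEdges R ≤ edgeCount G
edgeInjective⇒countEdges≤ {R = R} G φ maps inj =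
  subst (_ ≤_) (sym (edgeCount≡countEdges G))
    (injectiveOn⇒countIn≤ *↔× *↔× {Q = upper (adj G)} image image-edge image-injective)
  where
  image : Pair _ → Pair (n G)
  image (i , j) = ⟪ φ i , φ j ⟫
  image-edge : ∀ e → T (upper R e) → T (upper (adj G) (image e))
  image-edge (i , j) e = upper-⟪⟫ (adj-sym G) (adj⇒≢ G a) a
    where a = maps (∧-elimˡ e)
  image-injective : InjectiveOn (upper R) image
  image-injective e e′ eq =
    SameEdge-< (upper-< {R = R} e) (upper-< {R = R} e′)
      (inj (∧-elimˡ e) (∧-elimˡ e′) (⟪⟫≡⇒SameEdge eq))

-- Spanning trees

record SpanningTree (G : Graph) (r : Fin (n G)) : Set where
  field
    depth        : Fin (n G) → ℕ
    parent       : Fin (n G) → Fin (n G)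
    parent-adj   : ∀ {v} → v ≢ r → T (adj G v (parent v))
    parent-depth : ∀ {v} → v ≢ r → depth (parent v) < depth v

  isTreeEdge : Fin (n G) → Fin (n G) → Bool
  isTreeEdge u v = (not (u == r) ∧ (parent u == v)) ∨ (not (v == r) ∧ (parent v == u))

  isTreeEdge-sym : ∀ u v → isTreeEdge u v ≡ isTreeEdge v u
  isTreeEdge-sym u v = ∨-comm (not (u == r) ∧ (parent u == v)) _

  parent-isTreeEdge : ∀ {v} → v ≢ r → T (isTreeEdge v (parent v))
  parent-isTreeEdge v≢r =
    Equivalence.from T-∨ (inj₁ (∧-intro (≢⇒not== v≢r) (≡⇒== {i = parent _} refl)))

  isTreeEdge⇒ : ∀ {u v} → T (isTreeEdge u v) → ∃ λ c → c ≢ r × ⟪ u , v ⟫ ≡ ⟪ c , parent c ⟫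
  isTreeEdge⇒ {u} {v} e with Equivalence.to T-∨ e
  ... | inj₁ e′ = u , not==⇒≢ (∧-elimˡ e′) , SameEdge⇒⟪⟫≡ (inj₁ (refl , sym (==⇒≡ (∧-elimʳ e′))))
  ... | inj₂ e′ = v , not==⇒≢ (∧-elimˡ e′) , SameEdge⇒⟪⟫≡ (inj₂ (sym (==⇒≡ (∧-elimʳ e′)) , refl))

  nonTreeEdges : Graph
  nonTreeEdges = record
    { n          = n G
    ; adj        = λ u v → adj G u v ∧ not (isTreeEdge u v)
    ; adj-sym    = λ u v → cong₂ _∧_ (adj-sym G u v) (cong not (isTreeEdge-sym u v))
    ; adj-irrefl = λ v → cong (_∧ not (isTreeEdge v v)) (adj-irrefl G v)
    }

  nonRoots≤treeEdges : count (λ v → not (v == r)) ≤ countEdges (λ u v → adj G u v ∧ isTreeEdge u v)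
  nonRoots≤treeEdges =
    injectiveOn⇒countIn≤ ↔-refl *↔× {Q = upper treeEdge} (λ v → ⟪ v , parent v ⟫) maps injective
    where
    treeEdge : Fin (n G) → Fin (n G) → Bool
    treeEdge u v = adj G u v ∧ isTreeEdge u v
    maps : ∀ v → T (not (v == r)) → T (upper treeEdge ⟪ v , parent v ⟫)
    maps v v≢r = upper-⟪⟫ (λ u v → cong₂ _∧_ (adj-sym G u v) (isTreeEdge-sym u v))
      (adj⇒≢ G a) (∧-intro a (parent-isTreeEdge (not==⇒≢ v≢r)))
      where a = parent-adj (not==⇒≢ v≢r)
    injective : InjectiveOn (λ v → not (v == r)) (λ v → ⟪ v , parent v ⟫)
    injective v≢r v′≢r eq with ⟪⟫≡⇒SameEdge eq
    ... | inj₁ (v≡v′ , _)      = v≡v′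
    ... | inj₂ (v≡pv′ , pv≡v′) = ⊥-elim (<-asym
      (subst (λ w → depth w < depth _) pv≡v′ (parent-depth (not==⇒≢ v≢r)))
      (subst (λ w → depth w < depth _) (sym v≡pv′) (parent-depth (not==⇒≢ v′≢r))))

  edgeCount-nonTreeEdges : n G + edgeCount nonTreeEdges ≤ suc (edgeCount G)
  edgeCount-nonTreeEdges = begin
    n G + edgeCount nonTreeEdges
      ≡⟨ cong₂ _+_ (sym (count-≢ r)) (edgeCount≡countEdges nonTreeEdges) ⟩
    suc (count (λ v → not (v == r)) + countEdges (adj nonTreeEdges))
      ≤⟨ s≤s (+-monoˡ-≤ _ nonRoots≤treeEdges) ⟩
    suc (countEdges (λ u v → adj G u v ∧ isTreeEdge u v) + countEdges (adj nonTreeEdges))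
      ≡⟨ cong suc (countEdges-split (adj G) isTreeEdge) ⟨
    suc (countEdges (adj G))
      ≡⟨ cong suc (edgeCount≡countEdges G) ⟨
    suc (edgeCount G) ∎
    where open ≤-Reasoning

Least : (ℕ → Bool) → ℕ → Set
Least P d = T (P d) × (∀ k → T (P k) → d ≤ k)

least : (P : ℕ → Bool) → ∀ k → T (P k) → ∃ (Least P)
least P zero    p = 0 , p , λ _ _ → z≤n
least P (suc k) p with P 0 in eq
... | true  = 0 , subst T (sym eq) _ , λ _ _ → z≤n
... | false with least (P ∘ suc) k p
...   | d , q , minimal = suc d , q , λ where
  zero    p₀ → ⊥-elim (subst T eq p₀)
  (suc j) pⱼ → s≤s (minimal j pⱼ)

module BreadthFirst (G : Graph) (r : Fin (n G)) (reach : ∀ v → Reach G v r) where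

  walk : ℕ → Fin (n G) → Bool
  walk zero    v = v == r
  walk (suc k) v = ⌊ any? (λ w → T? (adj G v w ∧ walk k w)) ⌋

  Reach⇒walk : ∀ {v} → Reach G v r → ∃ λ k → T (walk k v)
  Reach⇒walk here = 0 , ≡⇒== {i = r} refl
  Reach⇒walk (step a rest) with Reach⇒walk rest
  ... | k , p = suc k , fromWitness (_ , ∧-intro a p)

  shortest : ∀ v → ∃ (Least (λ k → walk k v))
  shortest v = least (λ k → walk k v) (proj₁ (Reach⇒walk (reach v))) (proj₂ (Reach⇒walk (reach v)))

  depth : Fin (n G) → ℕ
  depth v = proj₁ (shortest v)

  descend : ∀ {v d} → Least (λ k → walk k v) d → v ≢ r → ∃ λ w → T (adj G v w) × depth w < d
  descend {d = zero}  (p , _) v≢r = ⊥-elim (v≢r (==⇒≡ p))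
  descend {d = suc d} (p , _) v≢r with toWitness p
  ... | w , q = w , ∧-elimˡ q , s≤s (proj₂ (proj₂ (shortest w)) d (∧-elimʳ q))

  parent : Fin (n G) → Fin (n G)
  parent v with v ≟ r
  ... | yes _   = r
  ... | no  v≢r = proj₁ (descend (proj₂ (shortest v)) v≢r)

  parent-adj : ∀ {v} → v ≢ r → T (adj G v (parent v))
  parent-adj {v} v≢r with v ≟ r
  ... | yes v≡r  = ⊥-elim (v≢r v≡r)
  ... | no  v≢r′ = proj₁ (proj₂ (descend (proj₂ (shortest v)) v≢r′))

  parent-depth : ∀ {v} → v ≢ r → depth (parent v) < depth v
  parent-depth {v} v≢r with v ≟ r
  ... | yes v≡r  = ⊥-elim (v≢r v≡r)
  ... | no  v≢r′ = proj₂ (proj₂ (descend (proj₂ (shortest v)) v≢r′))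

  spanningTree : SpanningTree G r
  spanningTree = record
    { depth = depth ; parent = parent ; parent-adj = parent-adj ; parent-depth = parent-depth }

-- Colourings by the larger endpoint

module OwnerColouring (S : Graph) (key : Fin (n S) → ℕ) (key-injective : Injective _≡_ _≡_ key)
  where

  owner : Fin (n S) → Fin (n S) → Fin (n S)
  owner = larger key

  owner-SameEdge : ∀ {x y x′ y′} → SameEdge x y x′ y′ → owner x y ≡ owner x′ y′
  owner-SameEdge (inj₁ (refl , refl)) = refl
  owner-SameEdge {x} {y} (inj₂ (refl , refl)) = cong proj₂ (sortBy-comm key-injective x y)

  pairCode : Pair (n S) → ℕ
  pairCode (x , y) = n S + toℕ (combine x y)

  colour : Coloring (n S)
  colour x y = if adj S x y then pairCode ⟪ x , y ⟫ else toℕ (owner x y)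

  colour-sym : SymColoring (n S) colour
  colour-sym x y rewrite adj-sym S x y | ⟪⟫-comm x y | sortBy-comm key-injective x y = refl

  colour-owner : ∀ {x y} → ¬ T (adj S x y) → colour x y ≡ toℕ (owner x y)
  colour-owner {x} {y} ¬s with adj S x y
  ... | true  = ⊥-elim (¬s _)
  ... | false = refl

  pairCode-injective : ∀ {p q} → pairCode p ≡ pairCode q → p ≡ q
  pairCode-injective {x , y} {x′ , y′} eq with combine-injective x y x′ y′
    (toℕ-injective (+-cancelˡ-≡ (n S) _ _ eq))
  ... | refl , refl = refl

  pairCode≢toℕ : ∀ p z → pairCode p ≢ toℕ z
  pairCode≢toℕ p z eq = <-irrefl (sym eq) (≤-trans (toℕ<n z) (m≤m+n (n S) _))

  colour-≡-cases : ∀ {x y x′ y′} → colour x y ≡ colour x′ y′ →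
    (T (adj S x y) × T (adj S x′ y′) × SameEdge x y x′ y′) ⊎
    (¬ T (adj S x y) × ¬ T (adj S x′ y′) × owner x y ≡ owner x′ y′)
  colour-≡-cases {x} {y} {x′} {y′} eq with adj S x y | adj S x′ y′
  ... | true  | true  = inj₁ (_ , _ , ⟪⟫≡⇒SameEdge (pairCode-injective eq))
  ... | true  | false = ⊥-elim (pairCode≢toℕ _ _ eq)
  ... | false | true  = ⊥-elim (pairCode≢toℕ _ _ (sym eq))
  ... | false | false = inj₂ ((λ ()) , (λ ()) , toℕ-injective eq)

  module _ (H : Graph) (copy : RainbowCopy H (n S) colour) where

    private
      φ : Fin (n H) → Fin (n S)
      φ = proj₁ copy

      φ-injective : Injective _≡_ _≡_ φ
      φ-injective = proj₁ (proj₂ copy) _ _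

      κ : Fin (n H) → ℕ
      κ = key ∘ φ

    special : Fin (n H) → Fin (n H) → Bool
    special i j = adj S (φ i) (φ j)

    ordinary : Fin (n H) → Fin (n H) → Bool
    ordinary i j = adj H i j ∧ not (special i j)

    special-countEdges≤ : countEdges (λ i j → adj H i j ∧ special i j) ≤ edgeCount S
    special-countEdges≤ =
      edgeInjective⇒countEdges≤ S φ (λ {i} {j} → ∧-elimʳ {adj H i j})
        (λ _ _ → SameEdge-injective φ-injective)

    module _ {i j} (o : T (upper ordinary (i , j))) where

      ordinary-adj : T (adj H i j)
      ordinary-adj = ∧-elimˡ (∧-elimˡ {ordinary i j} o)

      ordinary-colour : colour (φ i) (φ j) ≡ toℕ (φ (larger κ i j))
      ordinary-colour = trans
        (colour-owner (T-not⁻ (∧-elimʳ {adj H i j} (∧-elimˡ {ordinary i j} o))))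
        (cong toℕ (sym (larger-∘ key φ)))

    ordinary-countEdges≤ : ∀ w → (∀ v → κ w ≤ κ v) →
      countEdges ordinary ≤ count (λ v → not (v == w))
    ordinary-countEdges≤ w w-lowest =
      injectiveOn⇒countIn≤ *↔× ↔-refl (uncurry (larger κ)) above-w injective
      where
      above-w : ∀ e → T (upper ordinary e) → T (not (uncurry (larger κ) e == w))
      above-w (i , j) o = ≢⇒not== λ eq → <-irrefl (cong κ (sym eq))
        (≤-<-trans (w-lowest _)
          (sortBy-sorted (φ-injective ∘ key-injective) (adj⇒≢ H (ordinary-adj o))))
      injective : InjectiveOn (upper ordinary) (uncurry (larger κ))
      injective {i , j} {i′ , j′} o o′ eq =
        SameEdge-< (upper-< {R = ordinary} o) (upper-< {R = ordinary} o′)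
          (proj₂ (proj₂ copy) i j i′ j′ (ordinary-adj o) (ordinary-adj o′)
            (trans (ordinary-colour o) (trans (cong (toℕ ∘ φ) eq) (sym (ordinary-colour o′)))))

    rainbow-edgeCount : 0 < n H → edgeCount H < n H + edgeCount S
    rainbow-edgeCount 0<n = begin-strict
      edgeCount H
        ≡⟨ edgeCount≡countEdges H ⟩
      countEdges (adj H)
        ≡⟨ countEdges-split (adj H) special ⟩
      countEdges (λ i j → adj H i j ∧ special i j) + countEdges ordinary
        ≤⟨ +-mono-≤ special-countEdges≤ (ordinary-countEdges≤ lowest lowest-≤) ⟩
      edgeCount S + count (λ v → not (v == lowest))
        <⟨ +-monoʳ-< (edgeCount S) (≤-reflexive (count-≢ lowest)) ⟩
      edgeCount S + n H
        ≡⟨ +-comm (edgeCount S) (n H) ⟩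
      n H + edgeCount S ∎
      where
      open ≤-Reasoning
      lowest : Fin (n H)
      lowest = argmin κ (fromℕ< 0<n) (allFin (n H))
      lowest-≤ : ∀ v → κ lowest ≤ κ v
      lowest-≤ v = All.lookup (f[argmin]≤f[xs] (fromℕ< 0<n) (allFin (n H))) (∈-allFin v)

-- The colouring for H₂

module _ (s : ℕ) (G : Graph) where

  withIsolatedAdj : Fin (n G + s) → Fin (n G + s) → Bool
  withIsolatedAdj x y with splitAt (n G) x | splitAt (n G) y
  ... | inj₁ u | inj₁ v = adj G u v
  ... | _      | _      = false

  withIsolated : Graph
  withIsolated = record
    { n = n G + s ; adj = withIsolatedAdj ; adj-sym = sym′ ; adj-irrefl = irrefl }
    where
    sym′ : ∀ x y → withIsolatedAdj x y ≡ withIsolatedAdj y x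
    sym′ x y with splitAt (n G) x | splitAt (n G) y
    ... | inj₁ u | inj₁ v = adj-sym G u v
    ... | inj₁ _ | inj₂ _ = refl
    ... | inj₂ _ | inj₁ _ = refl
    ... | inj₂ _ | inj₂ _ = refl
    irrefl : ∀ x → withIsolatedAdj x x ≡ false
    irrefl x with splitAt (n G) x
    ... | inj₁ u = adj-irrefl G u
    ... | inj₂ _ = refl

  withIsolated-↑ˡ : ∀ u v → adj withIsolated (u ↑ˡ s) (v ↑ˡ s) ≡ adj G u v
  withIsolated-↑ˡ u v rewrite splitAt-↑ˡ (n G) u s | splitAt-↑ˡ (n G) v s = refl

  withIsolated-↑ʳ : ∀ i y → adj withIsolated (n G ↑ʳ i) y ≡ false
  withIsolated-↑ʳ i y rewrite splitAt-↑ʳ (n G) s i = refl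

  withIsolated-edge : ∀ {x y} → T (adj withIsolated x y) → ∃ λ u → ∃ λ v → x ≡ u ↑ˡ s × y ≡ v ↑ˡ s
  withIsolated-edge {x} {y} e with splitAt (n G) x in ex | splitAt (n G) y in ey
  ... | inj₁ u | inj₁ v = u , v , sym (splitAt⁻¹-↑ˡ ex) , sym (splitAt⁻¹-↑ˡ ey)

  -- The vertex is only a target for the isolated vertices.
  edgeCount-withIsolated : Fin (n G) → edgeCount withIsolated ≤ edgeCount G
  edgeCount-withIsolated v₀ = subst (_≤ edgeCount G) (sym (edgeCount≡countEdges withIsolated))
    (edgeInjective⇒countEdges≤ G restrict maps injective)
    where
    restrict : Fin (n G + s) → Fin (n G)
    restrict x = [ id , const v₀ ]′ (splitAt (n G) x)
    restrict-↑ˡ : ∀ u → restrict (u ↑ˡ s) ≡ u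
    restrict-↑ˡ u rewrite splitAt-↑ˡ (n G) u s = refl
    maps : ∀ {x y} → T (adj withIsolated x y) → T (adj G (restrict x) (restrict y))
    maps e with withIsolated-edge e
    ... | u , v , refl , refl rewrite restrict-↑ˡ u | restrict-↑ˡ v =
      subst T (withIsolated-↑ˡ u v) e
    injective : ∀ {x y x′ y′} → T (adj withIsolated x y) → T (adj withIsolated x′ y′) →
      SameEdge (restrict x) (restrict y) (restrict x′) (restrict y′) → SameEdge x y x′ y′
    injective e e′ same with withIsolated-edge e | withIsolated-edge e′
    ... | u , v , refl , refl | u′ , v′ , refl , refl
      rewrite restrict-↑ˡ u | restrict-↑ˡ v | restrict-↑ˡ u′ | restrict-↑ˡ v′ =
      SameEdge-map (_↑ˡ s) same

+-*-injectiveˡ : ∀ {m i j} a c → i < m → j < m → i + a * m ≡ j + c * m → i ≡ j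
+-*-injectiveˡ {suc m} {i} {j} a c i<m j<m eq = begin
  i                       ≡⟨ m<n⇒m%n≡m i<m ⟨
  i % suc m               ≡⟨ [m+kn]%n≡m%n i a (suc m) ⟨
  (i + a * suc m) % suc m ≡⟨ cong (_% suc m) eq ⟩
  (j + c * suc m) % suc m ≡⟨ [m+kn]%n≡m%n j c (suc m) ⟩
  j % suc m               ≡⟨ m<n⇒m%n≡m j<m ⟩
  j                       ∎
  where open ≡-Reasoning

+-*-< : ∀ {m i} j {a c} → i < m → a < c → i + a * m < j + c * m
+-*-< {m} {i} j {a} {c} i<m a<c = begin-strict
  i + a * m  <⟨ +-monoˡ-< (a * m) i<m ⟩
  suc a * m  ≤⟨ *-monoˡ-≤ m a<c ⟩
  c * m      ≤⟨ m≤n+m (c * m) j ⟩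
  j + c * m  ∎
  where open ≤-Reasoning

module Construction (G : Graph) {r : Fin (n G)} (tree : SpanningTree G r) (t : ℕ) where
  open SpanningTree tree

  specialEdges : Graph
  specialEdges = withIsolated (suc t) nonTreeEdges

  m : ℕ
  m = n specialEdges

  embed : Fin (n G) → Fin m
  embed v = v ↑ˡ suc t

  extra : Fin (suc t) → Fin m
  extra i = n G ↑ʳ i

  level : Fin m → ℕ
  level x = [ depth , const 0 ]′ (splitAt (n G) x)

  -- Depth first, so that a tree edge is owned by its child.
  key : Fin m → ℕ
  key x = toℕ x + level x * m

  key-injective : Injective _≡_ _≡_ key
  key-injective {x} {y} = toℕ-injective ∘ +-*-injectiveˡ (level x) (level y) (toℕ<n x) (toℕ<n y)

  open OwnerColouring specialEdges key key-injective public

  key-embed : ∀ v → key (embed v) ≡ toℕ v + depth v * m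
  key-embed v rewrite splitAt-↑ˡ (n G) v (suc t) | toℕ-↑ˡ v (suc t) = refl

  key-extra : ∀ i → key (extra i) ≡ n G + toℕ i
  key-extra i rewrite splitAt-↑ʳ (n G) (suc t) i | toℕ-↑ʳ (n G) i = +-identityʳ _

  owner-parent : ∀ {c} → c ≢ r → owner (embed c) (embed (parent c)) ≡ embed c
  owner-parent {c} c≢r = larger-> key (subst₂ _<_ (sym (key-embed (parent c))) (sym (key-embed c))
    (+-*-< (toℕ c) (≤-trans (toℕ<n (parent c)) (m≤m+n (n G) (suc t))) (parent-depth c≢r)))

  ordinary⇒treeEdge : ∀ {u v} → T (adj G u v) → ¬ T (adj specialEdges (embed u) (embed v)) →
    ∃ λ c → ⟪ u , v ⟫ ≡ ⟪ c , parent c ⟫ × owner (embed u) (embed v) ≡ embed c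
  ordinary⇒treeEdge {u} {v} a ¬s with isTreeEdge⇒ isTree
    where
    isTree : T (isTreeEdge u v)
    isTree = decidable-stable (T? _) λ ¬tree →
      ¬s (subst T (sym (withIsolated-↑ˡ (suc t) nonTreeEdges u v)) (∧-intro a (T-not ¬tree)))
  ... | c , c≢r , e =
    c , e , trans (owner-SameEdge (SameEdge-map embed (⟪⟫≡⇒SameEdge e))) (owner-parent c≢r)

  embed-rainbow : RainbowCopy G m colour
  embed-rainbow = embed , (λ u v → ↑ˡ-injective (suc t) u v) , rainbow
    where
    rainbow : ∀ u v u′ v′ → T (adj G u v) → T (adj G u′ v′) →
      colour (embed u) (embed v) ≡ colour (embed u′) (embed v′) → SameEdge u v u′ v′
    rainbow u v u′ v′ a a′ eq with colour-≡-cases eq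
    ... | inj₁ (_ , _ , same) = SameEdge-injective (↑ˡ-injective (suc t) _ _) same
    ... | inj₂ (¬s , ¬s′ , owners) with ordinary⇒treeEdge a ¬s | ordinary⇒treeEdge a′ ¬s′
    ...   | c , e , o | c′ , e′ , o′
      with ↑ˡ-injective (suc t) c c′ (trans (sym o) (trans owners o′))
    ...     | refl = ⟪⟫≡⇒SameEdge (trans e (sym e′))

  manyColours : ColoredInAtLeast m colour t
  manyColours =
    (λ k → extra (suc k) , extra zero) , (λ k → 0≢1+n ∘ sym ∘ ↑ʳ-injective (n G) _ _) , injective
    where
    colour-extra : ∀ k → colour (extra (suc k)) (extra zero) ≡ toℕ (extra (suc k))
    colour-extra k = begin
      colour (extra (suc k)) (extra zero)
        ≡⟨ colour-owner (subst T (withIsolated-↑ʳ (suc t) nonTreeEdges (suc k) (extra zero))) ⟩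
      toℕ (owner (extra (suc k)) (extra zero))
        ≡⟨ cong toℕ (larger-> key (subst₂ _<_ (sym (key-extra zero)) (sym (key-extra (suc k)))
             (+-monoʳ-< (n G) (s≤s z≤n)))) ⟩
      toℕ (extra (suc k)) ∎
      where open ≡-Reasoning
    injective : ∀ k l →
      colour (extra (suc k)) (extra zero) ≡ colour (extra (suc l)) (extra zero) → k ≡ l
    injective k l eq = suc-injective (↑ʳ-injective (n G) _ _
      (toℕ-injective (trans (sym (colour-extra k)) (trans eq (colour-extra l)))))

  specialEdges≤nonTreeEdges : edgeCount specialEdges ≤ edgeCount nonTreeEdges
  specialEdges≤nonTreeEdges = edgeCount-withIsolated (suc t) nonTreeEdges r

-- Dimension

dim≡ : ∀ G → dim G ≡ (edgeCount G + 1) ⊖ n G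
dim≡ G = trans (cong (ℤ._+ ℤ.+ 1) (ℤₚ.[+m]-[+n]≡m⊖n (edgeCount G) (n G)))
               (ℤₚ.distribˡ-⊖-+-pos 1 (edgeCount G) (n G))

[m+n]⊖m≡n : ∀ m n → (m + n) ⊖ m ≡ ℤ.+ n
[m+n]⊖m≡n m n = trans (ℤₚ.⊖-≥ (m≤m+n m n)) (cong ℤ.+_ (m+n∸m≡n m n))

dim-≤ : ∀ G {F} → edgeCount G < n G + F → dim G ℤ.≤ ℤ.+ F
dim-≤ G {F} E<n+F = begin
  dim G
    ≡⟨ dim≡ G ⟩
  (edgeCount G + 1) ⊖ n G
    ≤⟨ ℤₚ.⊖-monoˡ-≤ (n G) (subst (_≤ n G + F) (+-comm 1 (edgeCount G)) E<n+F) ⟩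
  (n G + F) ⊖ n G
    ≡⟨ [m+n]⊖m≡n (n G) F ⟩
  ℤ.+ F ∎
  where open ℤₚ.≤-Reasoning

≤-dim : ∀ G {F} → n G + F ≤ suc (edgeCount G) → ℤ.+ F ℤ.≤ dim G
≤-dim G {F} n+F≤E+1 = begin
  ℤ.+ F
    ≡⟨ [m+n]⊖m≡n (n G) F ⟨
  (n G + F) ⊖ n G
    ≤⟨ ℤₚ.⊖-monoˡ-≤ (n G) (subst (n G + F ≤_) (+-comm 1 (edgeCount G)) n+F≤E+1) ⟩
  (edgeCount G + 1) ⊖ n G
    ≡⟨ dim≡ G ⟨
  dim G ∎
  where open ℤₚ.≤-Reasoning

theorem4 : (H₁ H₂ : Graph) → InℋClass H₁ → InℋClass H₂ → H₁ ≼ H₂ → dim H₁ ℤ.≤ dim H₂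
theorem4 H₁ H₂ ((0<n₁ , _) , _) ((0<n₂ , reach) , _) (t , H₁≼H₂) =
  decidable-stable (dim H₁ ℤₚ.≤? dim H₂) λ dim₁≰dim₂ →
    H₁≼H₂ m colour colour-sym manyColours (dim₁≰dim₂ ∘ dim-bound) embed-rainbow
  where
  tree : SpanningTree H₂ (fromℕ< 0<n₂)
  tree = BreadthFirst.spanningTree H₂ (fromℕ< 0<n₂) (λ v → reach v (fromℕ< 0<n₂))
  open Construction H₂ tree t
  open SpanningTree tree using (nonTreeEdges; edgeCount-nonTreeEdges)
  dim-bound : RainbowCopy H₁ m colour → dim H₁ ℤ.≤ dim H₂
  dim-bound copy = begin
    dim H₁                     ≤⟨ dim-≤ H₁ (rainbow-edgeCount H₁ copy 0<n₁) ⟩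
    ℤ.+ edgeCount specialEdges ≤⟨ ℤ.+≤+ specialEdges≤nonTreeEdges ⟩
    ℤ.+ edgeCount nonTreeEdges ≤⟨ ≤-dim H₂ edgeCount-nonTreeEdges ⟩
    dim H₂                     ∎
    where open ℤₚ.≤-Reasoning
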